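{- Let $k$, $n$, $r$ be positive integers with $n\ge 2(k+r)$. Let $D$ be a minimum-cardinality $k$-dominating set of the Kneser graph $K(n,r)$, and let $\tilde u\subseteq[n]$ with $|\tilde u|=r-1$. Then there exists $x\in[n]\setminus\tilde u$ such that $\tilde u\cup\{x\}\notin D$.
   Context: For integers $n\ge 2r\ge 2$, the Kneser graph $K(n,r)$ has as vertices the $r$-element subsets of $[n]=\{1,\dots,n\}$, two vertices being adjacent iff they are disjoint. For a graph $G$ and positive integer $k$, a set $D\subseteq V(G)$ is a $k$-dominating set if every vertex $u\in V(G)\setminus D$ has at least $k$ neighbors in $D$. -}

module Defs where

open import Data.Nat using (ℕ; _≤_; _≟_)
open import Data.Fin using (Fin)
open import Data.Fin.Subset using (Subset; ∣_∣; _∩_; _∈_; _∉_; _∪_; ⁅_⁆; _⊆_)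
open import Data.List using (List; length; filter)
open import Data.List.Relation.Unary.All using (All)
open import Data.List.Relation.Unary.Unique.Propositional using (Unique)
import Data.List.Membership.Propositional as LM
open import Relation.Binary.PropositionalEquality using (_≡_)
open import Relation.Nullary using (¬_)

IsVertex : (n r : ℕ) → Subset n → Set
IsVertex n r u = ∣ u ∣ ≡ r

Disjoint : {n : ℕ} → Subset n → Subset n → Set
Disjoint u v = ∣ u ∩ v ∣ ≡ 0

-- A finite set of vertices of K(n,r), represented as a duplicate-free list of
-- r-subsets of [n]; its cardinality is the list length.
IsVertexSet : (n r : ℕ) → List (Subset n) → Set
IsVertexSet n r D = Unique D × All (IsVertex n r) D
  where open import Data.Product using (_×_)

neighboursIn : {n : ℕ} → Subset n → List (Subset n) → ℕ
neighboursIn u D = length (filter (λ v → ∣ u ∩ v ∣ ≟ 0) D)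

IsKDominating : (n r k : ℕ) → List (Subset n) → Set
IsKDominating n r k D =
  IsVertexSet n r D ×
  ((u : Subset n) → IsVertex n r u → ¬ (u LM.∈ D) → k ≤ neighboursIn u D)
  where open import Data.Product using (_×_)

IsMinKDominating : (n r k : ℕ) → List (Subset n) → Set
IsMinKDominating n r k D =
  IsKDominating n r k D ×
  ((D' : List (Subset n)) → IsKDominating n r k D' → length D ≤ length D')
  where open import Data.Product using (_×_)

-- Suppose every ũ ∪ {x} with x ∉ ũ lies in D. Outside ũ pick k + r points X
-- and k + 1 further points Y, and k distinct r-subsets A of X. Drop from D the
-- vertices that contain ũ and miss X (among them the k + 1 sets ũ ∪ {y}, y ∈ Y)
-- and add A. A dropped vertex is adjacent to all of A; a vertex meeting ũ
-- keeps all its neighbours; a vertex missing ũ still sees the at least k sets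
-- ũ ∪ {x} with x ∈ X outside it. This gives a smaller k-dominating set.
module Submission where

open import Data.Nat using (ℕ; suc; _+_; _*_; _∸_; _≤_; _<_; z≤n; s≤s)
open import Data.Nat.Properties
open import Data.Fin using (Fin; zero; suc)
open import Data.Product using (Σ; ∃₂; _×_; _,_; proj₁; proj₂)
open import Data.Sum using (inj₁; inj₂)
open import Data.Empty using (⊥-elim)
open import Data.List using (List; []; _∷_; _++_; length; filter; map; foldr; take; drop; allFin)
open import Data.List.Properties using (length-++; length-map; take++drop≡id; length-take)
open import Data.List.Membership.Propositional.Properties
open import Data.List.Relation.Unary.All as All using (All; []; _∷_; lookup; tabulate; all?)
open import Data.List.Relation.Unary.Any using (here; there)
open import Data.List.Relation.Unary.AllPairs using ([]; _∷_)
open import Data.List.Relation.Unary.Unique.Propositional using (Unique)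
import Data.List.Relation.Unary.Unique.Propositional.Properties as Unique
import Data.List.Relation.Unary.All.Properties as All
open import Data.List.Relation.Binary.Subset.Propositional using (_⊆_)
open import Function using (_∘_)
open import Relation.Nullary using (¬_; Dec; yes; no; ¬?; contradiction)
open import Relation.Unary using (Pred; Decidable)
open import Relation.Unary.Properties using (∁?)
open import Relation.Binary.PropositionalEquality
open import Relation.Nullary.Decidable using (_×-dec_; decidable-stable)
open import Data.Fin.Subset using (Subset; ∣_∣; _∪_; ⁅_⁆)
open import Data.Fin.Subset.Properties using (_∈?_)
open import Data.Fin.Properties using (any?)
open import Defs

module UniqueList {a} {A : Set a} where

  open import Data.List.Membership.Propositional using (_∈_; _∉_)

  Unique⇒length≤ : {xs ys : List A} → Unique xs → xs ⊆ ys → length xs ≤ length ys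
  Unique⇒length≤ {[]} _ _ = z≤n
  Unique⇒length≤ {x ∷ xs} (x∉xs ∷ xs!) xs⊆ys with ∈-∃++ (xs⊆ys (here refl))
  ... | ys₁ , ys₂ , refl = begin
    suc (length xs)             ≤⟨ s≤s (Unique⇒length≤ xs! xs⊆ys₁++ys₂) ⟩
    suc (length (ys₁ ++ ys₂))   ≡⟨ cong suc (length-++ ys₁) ⟩
    suc (length ys₁ + length ys₂) ≡⟨ +-suc (length ys₁) (length ys₂) ⟨
    length ys₁ + suc (length ys₂) ≡⟨ length-++ ys₁ ⟨
    length (ys₁ ++ x ∷ ys₂)     ∎
    where
    open ≤-Reasoning
    xs⊆ys₁++ys₂ : xs ⊆ ys₁ ++ ys₂
    xs⊆ys₁++ys₂ z∈xs with ∈-++⁻ ys₁ (xs⊆ys (there z∈xs))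
    ... | inj₁ z∈ys₁         = ∈-++⁺ˡ z∈ys₁
    ... | inj₂ (here refl)   = ⊥-elim (lookup x∉xs z∈xs refl)
    ... | inj₂ (there z∈ys₂) = ∈-++⁺ʳ ys₁ z∈ys₂

  length-filter+length-filter-∁ : ∀ {p} {P : Pred A p} (P? : Decidable P) xs →
    length (filter P? xs) + length (filter (∁? P?) xs) ≡ length xs
  length-filter+length-filter-∁ P? [] = refl
  length-filter+length-filter-∁ P? (x ∷ xs) with P? x
  ... | yes _ = cong suc (length-filter+length-filter-∁ P? xs)
  ... | no  _ = trans (+-suc _ _) (cong suc (length-filter+length-filter-∁ P? xs))

  Unique-++⁻ : ∀ xs {ys : List A} → Unique (xs ++ ys) →
    Unique xs × Unique ys × (∀ {z} → z ∈ xs → z ∉ ys)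
  Unique-++⁻ []       ys!           = [] , ys! , λ ()
  Unique-++⁻ (x ∷ xs) (x∉xs++ys ∷ xs++ys!) with Unique-++⁻ xs xs++ys!
  ... | xs! , ys! , xs∩ys=∅ = All.++⁻ˡ xs x∉xs++ys ∷ xs! , ys! , λ where
    (here refl) → λ z∈ys → lookup (All.++⁻ʳ xs x∉xs++ys) z∈ys refl
    (there z∈xs) → xs∩ys=∅ z∈xs

  Unique-map⁺ : ∀ {b} {B : Set b} {f : A → B} {xs} →
    (∀ {x y} → x ∈ xs → y ∈ xs → f x ≡ f y → x ≡ y) → Unique xs → Unique (map f xs)
  Unique-map⁺ {xs = []} f-inj [] = []
  Unique-map⁺ {f = f} {x ∷ xs} f-inj (x∉xs ∷ xs!) =
    tabulate fx∉fxs ∷ Unique-map⁺ (λ x∈ y∈ → f-inj (there x∈) (there y∈)) xs!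
    where
    fx∉fxs : ∀ {w} → w ∈ map f xs → f x ≢ w
    fx∉fxs w∈ fx≡w with ∈-map⁻ f w∈
    ... | y , y∈xs , refl = lookup x∉xs y∈xs (f-inj (here refl) (there y∈xs) fx≡w)

  prefix-of-length : ∀ m (xs : List A) → m ≤ length xs →
    ∃₂ λ ys zs → xs ≡ ys ++ zs × length ys ≡ m
  prefix-of-length m xs m≤|xs| =
    take m xs , drop m xs , sym (take++drop≡id m xs) , trans (length-take m xs) (m≤n⇒m⊓n≡m m≤|xs|)

module FinSubset {n : ℕ} where

  open import Data.Fin.Subset using (_∈_; _∉_; ⊥; Empty; Lift; inside; outside) renaming (_⊆_ to _⊆ₛ_)
  open import Data.Fin.Subset.Properties
  open import Data.List.Membership.Propositional using () renaming (_∈_ to _∈ₗ_; _∉_ to _∉ₗ_)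
  open import Data.Vec as Vec using (_∷_)
  open UniqueList

  ∈p∪⁅x⁆ : ∀ (p : Subset n) x → x ∈ p ∪ ⁅ x ⁆
  ∈p∪⁅x⁆ p x = x∈p∪q⁺ (inj₂ (x∈⁅x⁆ x))

  p∪⁅x⁆-injective : ∀ {p : Subset n} {x y} → x ∉ p → p ∪ ⁅ x ⁆ ≡ p ∪ ⁅ y ⁆ → x ≡ y
  p∪⁅x⁆-injective {p} {x} {y} x∉p eq with x∈p∪q⁻ p ⁅ y ⁆ (subst (x ∈_) eq (∈p∪⁅x⁆ p x))
  ... | inj₁ x∈p  = ⊥-elim (x∉p x∈p)
  ... | inj₂ x∈⁅y⁆ = x∈⁅y⁆⇒x≡y y x∈⁅y⁆

  ∣p∪⁅x⁆∣≡1+∣p∣ : ∀ {m} {p : Subset m} {x} → x ∉ p → ∣ p ∪ ⁅ x ⁆ ∣ ≡ suc ∣ p ∣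
  ∣p∪⁅x⁆∣≡1+∣p∣ {suc m} {inside  ∷ p} {zero}  x∉p = ⊥-elim (x∉p Vec.here)
  ∣p∪⁅x⁆∣≡1+∣p∣ {suc m} {outside ∷ p} {zero}  x∉p = cong (suc ∘ ∣_∣) (∪-identityʳ p)
  ∣p∪⁅x⁆∣≡1+∣p∣ {suc m} {inside  ∷ p} {suc x} x∉p = cong suc (∣p∪⁅x⁆∣≡1+∣p∣ (x∉p ∘ Vec.there))
  ∣p∪⁅x⁆∣≡1+∣p∣ {suc m} {outside ∷ p} {suc x} x∉p = ∣p∪⁅x⁆∣≡1+∣p∣ (x∉p ∘ Vec.there)

  x∈p⇒∣p∣≢0 : ∀ {p : Subset n} {x} → x ∈ p → ∣ p ∣ ≢ 0
  x∈p⇒∣p∣≢0 {p} {x} x∈p ∣p∣≡0 = 1+n≰n (begin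
    1           ≡⟨ ∣⁅x⁆∣≡1 x ⟨
    ∣ ⁅ x ⁆ ∣   ≤⟨ p⊆q⇒∣p∣≤∣q∣ ⁅x⁆⊆p ⟩
    ∣ p ∣       ≡⟨ ∣p∣≡0 ⟩
    0           ∎)
    where
    open ≤-Reasoning
    ⁅x⁆⊆p : ⁅ x ⁆ ⊆ₛ p
    ⁅x⁆⊆p y∈⁅x⁆ = subst (_∈ p) (sym (x∈⁅y⁆⇒x≡y x y∈⁅x⁆)) x∈p

  Empty⇒∣p∣≡0 : ∀ {p : Subset n} → Empty p → ∣ p ∣ ≡ 0
  Empty⇒∣p∣≡0 p-empty = trans (cong ∣_∣ (Empty-unique p-empty)) (∣⊥∣≡0 n)

  fromList : List (Fin n) → Subset n
  fromList = foldr (λ x p → p ∪ ⁅ x ⁆) ⊥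

  ∈-fromList⁺ : ∀ {x xs} → x ∈ₗ xs → x ∈ fromList xs
  ∈-fromList⁺ {xs = x ∷ xs} (here refl) = ∈p∪⁅x⁆ (fromList xs) x
  ∈-fromList⁺ (there x∈xs)              = x∈p∪q⁺ (inj₁ (∈-fromList⁺ x∈xs))

  ∈-fromList⁻ : ∀ {x} xs → x ∈ fromList xs → x ∈ₗ xs
  ∈-fromList⁻ [] x∈⊥ = ⊥-elim (∉⊥ x∈⊥)
  ∈-fromList⁻ (y ∷ xs) x∈ with x∈p∪q⁻ (fromList xs) ⁅ y ⁆ x∈
  ... | inj₁ x∈xs  = there (∈-fromList⁻ xs x∈xs)
  ... | inj₂ x∈⁅y⁆ = here (x∈⁅y⁆⇒x≡y y x∈⁅y⁆)

  ∣fromList∣≡length : ∀ {xs} → Unique xs → ∣ fromList xs ∣ ≡ length xs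
  ∣fromList∣≡length {[]}     []           = ∣⊥∣≡0 n
  ∣fromList∣≡length {x ∷ xs} (x∉xs ∷ xs!) = trans
    (∣p∪⁅x⁆∣≡1+∣p∣ (λ x∈ → lookup x∉xs (∈-fromList⁻ xs x∈) refl))
    (cong suc (∣fromList∣≡length xs!))

  Unique⇒length≤∣p∣ : ∀ {xs} {p : Subset n} → Unique xs → All (_∈ p) xs → length xs ≤ ∣ p ∣
  Unique⇒length≤∣p∣ {xs} xs! xs⊆p = begin
    length xs         ≡⟨ ∣fromList∣≡length xs! ⟨
    ∣ fromList xs ∣   ≤⟨ p⊆q⇒∣p∣≤∣q∣ (lookup xs⊆p ∘ ∈-fromList⁻ xs) ⟩
    _ ∎
    where open ≤-Reasoning

  elements : Subset n → List (Fin n)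
  elements p = filter (_∈? p) (allFin n)

  Unique-elements : ∀ p → Unique (elements p)
  Unique-elements p = Unique.filter⁺ (_∈? p) (Unique.allFin⁺ n)

  ∈-elements⁺ : ∀ {p x} → x ∈ p → x ∈ₗ elements p
  ∈-elements⁺ {p} {x} = ∈-filter⁺ (_∈? p) (∈-allFin x)

  ∈-elements⁻ : ∀ {p x} → x ∈ₗ elements p → x ∈ p
  ∈-elements⁻ {p} x∈ = proj₂ (∈-filter⁻ (_∈? p) {xs = allFin n} x∈)

  length-elements : ∀ p → length (elements p) ≡ ∣ p ∣
  length-elements p = ≤-antisym
    (Unique⇒length≤∣p∣ (Unique-elements p) (tabulate ∈-elements⁻))
    (begin
      ∣ p ∣                         ≤⟨ p⊆q⇒∣p∣≤∣q∣ (∈-fromList⁺ ∘ ∈-elements⁺) ⟩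
      ∣ fromList (elements p) ∣     ≡⟨ ∣fromList∣≡length (Unique-elements p) ⟩
      length (elements p)           ∎)
    where open ≤-Reasoning

  distinctSubsets : ∀ k r' xs → Unique xs → k + r' ≤ length xs →
    Σ (List (Subset n)) λ A → Unique A × length A ≡ k × All (λ w → ∣ w ∣ ≡ suc r' × Lift (_∈ₗ xs) w) A
  distinctSubsets k r' xs xs! k+r'≤|xs| with prefix-of-length (k + r') xs k+r'≤|xs|
  ... | ys , zs , refl , |ys|≡k+r'
    with prefix-of-length k ys (subst (k ≤_) (sym |ys|≡k+r') (m≤m+n k r'))
  ... | ps , qs , refl , |ps|≡k with Unique-++⁻ ps (proj₁ (Unique-++⁻ (ps ++ qs) xs!))
  ... | ps! , qs! , ps∩qs=∅ =
    map insert ps , insert-unique , trans (length-map insert ps) |ps|≡k ,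
    All.map⁺ (tabulate insert-subset)
    where
    insert : Fin n → Subset n
    insert p = fromList qs ∪ ⁅ p ⁆

    ∉qs : ∀ {p} → p ∈ₗ ps → p ∉ fromList qs
    ∉qs p∈ps = ps∩qs=∅ p∈ps ∘ ∈-fromList⁻ qs

    insert-unique : Unique (map insert ps)
    insert-unique = Unique-map⁺ (λ p∈ps _ → p∪⁅x⁆-injective (∉qs p∈ps)) ps!

    |qs|≡r' : length qs ≡ r'
    |qs|≡r' = +-cancelˡ-≡ k _ _ (begin
      k + length qs           ≡⟨ cong (_+ length qs) |ps|≡k ⟨
      length ps + length qs   ≡⟨ length-++ ps ⟨
      length (ps ++ qs)       ≡⟨ |ys|≡k+r' ⟩
      k + r'                  ∎)
      where open ≡-Reasoning

    insert-subset : ∀ {p} → p ∈ₗ ps → ∣ insert p ∣ ≡ suc r' × Lift (_∈ₗ (ps ++ qs) ++ zs) (insert p)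
    insert-subset p∈ps =
      trans (∣p∪⁅x⁆∣≡1+∣p∣ (∉qs p∈ps)) (cong suc (trans (∣fromList∣≡length qs!) |qs|≡r')) , ∈xs
      where
      ∈xs : Lift (_∈ₗ (ps ++ qs) ++ zs) (insert _)
      ∈xs x∈ with x∈p∪q⁻ (fromList qs) _ x∈
      ... | inj₁ x∈qs  = ∈-++⁺ˡ (∈-++⁺ʳ ps (∈-fromList⁻ qs x∈qs))
      ... | inj₂ x∈⁅p⁆ = ∈-++⁺ˡ (∈-++⁺ˡ (subst (_∈ₗ ps) (sym (x∈⁅y⁆⇒x≡y _ x∈⁅p⁆)) p∈ps))

module Kneser where

  open import Data.Bool.Properties using () renaming (_≟_ to _≟ᵇ_)
  open import Data.Fin.Subset using (_∈_; _∉_; _∩_; ∁; Empty; Nonempty; Lift) renaming (_⊆_ to _⊆ₛ_)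
  open import Data.Fin.Subset.Properties
  open import Data.List.Membership.Propositional using () renaming (_∈_ to _∈ₗ_; _∉_ to _∉ₗ_)
  open import Data.Vec.Properties using (≡-dec)
  open import Relation.Binary.Definitions using (DecidableEquality)
  import Data.List.Membership.DecPropositional as DecMembership
  open UniqueList
  open FinSubset

  _≟ₛ_ : ∀ {n} → DecidableEquality (Subset n)
  _≟ₛ_ = ≡-dec _≟ᵇ_

  infix 4 _∈ₗ?_
  _∈ₗ?_ : ∀ {n} (v : Subset n) vs → Dec (v ∈ₗ vs)
  _∈ₗ?_ = DecMembership._∈?_ _≟ₛ_

  Unique⇒length≤neighboursIn : ∀ {n} (u : Subset n) {L E} → Unique L →
    All (λ w → w ∈ₗ E × Disjoint u w) L → length L ≤ neighboursIn u E
  Unique⇒length≤neighboursIn u L! L⊆neighbours = Unique⇒length≤ L! λ w∈L →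
    let (w∈E , u∩w=∅) = lookup L⊆neighbours w∈L in ∈-filter⁺ (λ v → ∣ u ∩ v ∣ ≟ 0) w∈E u∩w=∅

  module Replacement {n r k : ℕ} {D : List (Subset n)} (D-kDom : IsKDominating n r k D)
    {ũ : Subset n} (saturated : ∀ x → x ∉ ũ → ũ ∪ ⁅ x ⁆ ∈ₗ D)
    {X : List (Fin n)} (X! : Unique X) (X∩ũ=∅ : All (_∉ ũ) X) (k+r≤|X| : k + r ≤ length X)
    {A : List (Subset n)} (A! : Unique A) (|A|≡k : length A ≡ k)
    (A-sets : All (λ w → ∣ w ∣ ≡ r × Lift (_∈ₗ X) w) A)
    {Y : List (Fin n)} (Y! : Unique Y) (Y∩ũ=∅ : All (_∉ ũ) Y) (X∩Y=∅ : ∀ {z} → z ∈ₗ X → z ∉ₗ Y)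
    (k<|Y| : k < length Y)
    where

    Spare : Subset n → Set
    Spare v = ũ ⊆ₛ v × All (_∉ v) X

    spare? : Decidable Spare
    spare? v = ũ ⊆? v ×-dec all? (λ x → ¬? (x ∈? v)) X

    -- Members of A are left out here so that D' stays duplicate-free.
    Kept : Subset n → Set
    Kept v = ¬ Spare v × v ∉ₗ A

    kept? : Decidable Kept
    kept? v = ¬? (spare? v) ×-dec ¬? (v ∈ₗ? A)

    D' : List (Subset n)
    D' = A ++ filter kept? D

    extend : Fin n → Subset n
    extend x = ũ ∪ ⁅ x ⁆

    private
      D! : Unique D
      D! = proj₁ (proj₁ D-kDom)

      D-vertices : All (IsVertex n r) D
      D-vertices = proj₂ (proj₁ D-kDom)

      D-dominates : ∀ u → IsVertex n r u → u ∉ₗ D → k ≤ neighboursIn u D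
      D-dominates = proj₂ D-kDom

    D⊆D' : ∀ {v} → v ∈ₗ D → ¬ Spare v → v ∈ₗ D'
    D⊆D' {v} v∈D v-not-spare with v ∈ₗ? A
    ... | yes v∈A = ∈-++⁺ˡ v∈A
    ... | no  v∉A = ∈-++⁺ʳ A (∈-filter⁺ kept? v∈D (v-not-spare , v∉A))

    spare-dominated : ∀ {u} → Spare u → k ≤ neighboursIn u D'
    spare-dominated {u} (_ , X∩u=∅) = subst (_≤ neighboursIn u D') |A|≡k
      (Unique⇒length≤neighboursIn u A! (tabulate λ w∈A → ∈-++⁺ˡ w∈A , Empty⇒∣p∣≡0 (u∩w-empty w∈A)))
      where
      u∩w-empty : ∀ {w} → w ∈ₗ A → Empty (u ∩ w)
      u∩w-empty w∈A (z , z∈u∩w) with x∈p∩q⁻ u _ z∈u∩w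
      ... | z∈u , z∈w = lookup X∩u=∅ (proj₂ (lookup A-sets w∈A) z∈w) z∈u

    meeting-ũ-dominated : ∀ {u} → IsVertex n r u → u ∉ₗ D → Nonempty (u ∩ ũ) → k ≤ neighboursIn u D'
    meeting-ũ-dominated {u} u-vertex u∉D (z , z∈u∩ũ) = ≤-trans (D-dominates u u-vertex u∉D)
      (Unique⇒length≤neighboursIn u (Unique.filter⁺ _ D!) (tabulate neighbour-kept))
      where
      neighbour-kept : ∀ {v} → v ∈ₗ filter (λ v → ∣ u ∩ v ∣ ≟ 0) D → v ∈ₗ D' × Disjoint u v
      neighbour-kept v∈ with ∈-filter⁻ (λ v → ∣ u ∩ v ∣ ≟ 0) {xs = D} v∈
      ... | v∈D , u∩v=∅ = D⊆D' v∈D not-spare , u∩v=∅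
        where
        not-spare : ¬ Spare _
        not-spare (ũ⊆v , _) with x∈p∩q⁻ u ũ z∈u∩ũ
        ... | z∈u , z∈ũ = x∈p⇒∣p∣≢0 (x∈p∩q⁺ (z∈u , ũ⊆v z∈ũ)) u∩v=∅

    k≤|X∖u| : ∀ {u} → IsVertex n r u → k ≤ length (filter (∁? (_∈? u)) X)
    k≤|X∖u| {u} ∣u∣≡r = +-cancelʳ-≤ r k _ (begin
      k + r                   ≤⟨ k+r≤|X| ⟩
      length X                ≡⟨ length-filter+length-filter-∁ (_∈? u) X ⟨
      length X∩u + length X∖u ≤⟨ +-monoˡ-≤ (length X∖u) |X∩u|≤r ⟩
      r + length X∖u          ≡⟨ +-comm r _ ⟩
      length X∖u + r          ∎)
      where
      open ≤-Reasoning
      X∩u X∖u : List (Fin n)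
      X∩u = filter (_∈? u) X
      X∖u = filter (∁? (_∈? u)) X
      |X∩u|≤r : length X∩u ≤ r
      |X∩u|≤r = subst (length X∩u ≤_) ∣u∣≡r
        (Unique⇒length≤∣p∣ (Unique.filter⁺ _ X!) (All.all-filter (_∈? u) X))

    avoiding-ũ-dominated : ∀ {u} → IsVertex n r u → Empty (u ∩ ũ) → k ≤ neighboursIn u D'
    avoiding-ũ-dominated {u} u-vertex u∩ũ=∅ = begin
      k                          ≤⟨ k≤|X∖u| u-vertex ⟩
      length X∖u                 ≡⟨ length-map extend X∖u ⟨
      length (map extend X∖u)    ≤⟨ Unique⇒length≤neighboursIn u extensions-unique
                                      (All.map⁺ (tabulate neighbour)) ⟩
      neighboursIn u D'          ∎
      where
      open ≤-Reasoning
      X∖u : List (Fin n)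
      X∖u = filter (∁? (_∈? u)) X
      ∉ũ : ∀ {x} → x ∈ₗ X∖u → x ∉ ũ
      ∉ũ x∈ = lookup X∩ũ=∅ (proj₁ (∈-filter⁻ (∁? (_∈? u)) {xs = X} x∈))
      extensions-unique : Unique (map extend X∖u)
      extensions-unique = Unique-map⁺ (λ x∈ _ → p∪⁅x⁆-injective (∉ũ x∈)) (Unique.filter⁺ _ X!)
      neighbour : ∀ {x} → x ∈ₗ X∖u → ũ ∪ ⁅ x ⁆ ∈ₗ D' × Disjoint u (ũ ∪ ⁅ x ⁆)
      neighbour {x} x∈ with ∈-filter⁻ (∁? (_∈? u)) {xs = X} x∈
      ... | x∈X , x∉u = D⊆D' (saturated x (∉ũ x∈)) not-spare , Empty⇒∣p∣≡0 disjoint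
        where
        not-spare : ¬ Spare (ũ ∪ ⁅ x ⁆)
        not-spare (_ , X∩w=∅) = lookup X∩w=∅ x∈X (∈p∪⁅x⁆ ũ x)
        disjoint : Empty (u ∩ (ũ ∪ ⁅ x ⁆))
        disjoint (z , z∈) with x∈p∩q⁻ u _ z∈
        ... | z∈u , z∈w with x∈p∪q⁻ ũ ⁅ x ⁆ z∈w
        ...   | inj₁ z∈ũ  = u∩ũ=∅ (z , x∈p∩q⁺ (z∈u , z∈ũ))
        ...   | inj₂ z∈⁅x⁆ = x∉u (subst (_∈ u) (x∈⁅y⁆⇒x≡y x z∈⁅x⁆) z∈u)

    D'-kDominating : IsKDominating n r k D'
    D'-kDominating = (D'-unique , D'-vertices) , D'-dominates
      where
      D'-unique : Unique D'
      D'-unique = Unique.++⁺ A! (Unique.filter⁺ kept? D!)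
        λ (v∈A , v∈kept) → proj₂ (proj₂ (∈-filter⁻ kept? {xs = D} v∈kept)) v∈A

      D'-vertices : All (IsVertex n r) D'
      D'-vertices = All.++⁺ (All.map proj₁ A-sets) (All.filter⁺ kept? D-vertices)

      D'-dominates : ∀ u → IsVertex n r u → u ∉ₗ D' → k ≤ neighboursIn u D'
      D'-dominates u u-vertex u∉D' with u ∈ₗ? D | nonempty? (u ∩ ũ)
      ... | yes u∈D | _         = spare-dominated (decidable-stable (spare? u) (u∉D' ∘ D⊆D' u∈D))
      ... | no  u∉D | yes meets = meeting-ũ-dominated u-vertex u∉D meets
      ... | no  u∉D | no avoids = avoiding-ũ-dominated u-vertex avoids

    D'-shorter : length D' < length D
    D'-shorter = begin-strict
      length D'               ≡⟨ length-++ A ⟩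
      length A + length kept  ≡⟨ cong (_+ length kept) |A|≡k ⟩
      k + length kept         <⟨ +-monoˡ-< (length kept) k<|dropped| ⟩
      length dropped + length kept ≡⟨ +-comm (length dropped) _ ⟩
      length kept + length dropped ≡⟨ length-filter+length-filter-∁ kept? D ⟩
      length D                ∎
      where
      open ≤-Reasoning
      kept dropped : List (Subset n)
      kept = filter kept? D
      dropped = filter (∁? kept?) D

      spare-extension : ∀ {y} → y ∈ₗ Y → Spare (extend y)
      spare-extension {y} y∈Y = p⊆p∪q ⁅ y ⁆ , tabulate x∉extend
        where
        x∉extend : ∀ {x} → x ∈ₗ X → x ∉ extend y
        x∉extend {x} x∈X x∈ with x∈p∪q⁻ ũ ⁅ y ⁆ x∈
        ... | inj₁ x∈ũ  = lookup X∩ũ=∅ x∈X x∈ũ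
        ... | inj₂ x∈⁅y⁆ = X∩Y=∅ x∈X (subst (_∈ₗ Y) (sym (x∈⁅y⁆⇒x≡y y x∈⁅y⁆)) y∈Y)

      k<|dropped| : k < length dropped
      k<|dropped| = begin-strict
        k                    <⟨ k<|Y| ⟩
        length Y             ≡⟨ length-map extend Y ⟨
        length (map extend Y) ≤⟨ Unique⇒length≤ extensions-unique extensions-dropped ⟩
        length dropped       ∎
        where
        extensions-unique : Unique (map extend Y)
        extensions-unique = Unique-map⁺ (λ y∈ _ → p∪⁅x⁆-injective (lookup Y∩ũ=∅ y∈)) Y!

        extensions-dropped : map extend Y ⊆ dropped
        extensions-dropped w∈ with ∈-map⁻ extend w∈
        ... | y , y∈Y , refl = ∈-filter⁺ (∁? kept?) (saturated y (lookup Y∩ũ=∅ y∈Y))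
          λ (not-spare , _) → not-spare (spare-extension y∈Y)

  shorterKDominating : ∀ {n r' k} {D : List (Subset n)} → IsKDominating n (suc r') k D →
    ∀ {ũ} → (∀ x → x ∉ ũ → ũ ∪ ⁅ x ⁆ ∈ₗ D) →
    ∀ C → Unique C → All (_∉ ũ) C → (k + suc r') + suc k ≤ length C →
    Σ (List (Subset n)) λ D' → IsKDominating n (suc r') k D' × length D' < length D
  shorterKDominating {n} {r'} {k} D-kDom saturated C C! C∩ũ=∅ |C|-large
    with prefix-of-length (k + suc r') C (m+n≤o⇒m≤o (k + suc r') |C|-large)
  ... | X , Y , refl , |X|≡k+r with Unique-++⁻ X C!
  ... | X! , Y! , X∩Y=∅
    with distinctSubsets k r' X X! (≤-trans (+-monoʳ-≤ k (n≤1+n r')) (≤-reflexive (sym |X|≡k+r)))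
  ... | A , A! , |A|≡k , A-sets = D' , D'-kDominating , D'-shorter
    where
    k<|Y| : k < length Y
    k<|Y| = +-cancelˡ-≤ (k + suc r') _ _ (begin
      k + suc r' + suc k         ≤⟨ |C|-large ⟩
      length (X ++ Y)            ≡⟨ length-++ X ⟩
      length X + length Y        ≡⟨ cong (_+ length Y) |X|≡k+r ⟩
      k + suc r' + length Y      ∎)
      where open ≤-Reasoning

    open Replacement D-kDom saturated X! (All.++⁻ˡ X C∩ũ=∅) (≤-reflexive (sym |X|≡k+r))
      A! |A|≡k A-sets Y! (All.++⁻ʳ X C∩ũ=∅) X∩Y=∅ k<|Y|

  k+r+[1+k]≤∣∁p∣ : ∀ {n r' k} (p : Subset n) → ∣ p ∣ ≡ r' → 2 * (k + suc r') ≤ n →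
    k + suc r' + suc k ≤ ∣ ∁ p ∣
  k+r+[1+k]≤∣∁p∣ {n} {r'} {k} p ∣p∣≡r' 2[k+r]≤n = begin
    k + suc r' + suc k           ≤⟨ m+n≤o⇒m≤o∸n _ (begin
      k + suc r' + suc k + r'        ≡⟨ +-assoc (k + suc r') (suc k) r' ⟩
      k + suc r' + (suc k + r')      ≡⟨ cong (k + suc r' +_) (+-suc k r') ⟨
      k + suc r' + (k + suc r')      ≡⟨ cong (k + suc r' +_) (+-identityʳ (k + suc r')) ⟨
      2 * (k + suc r')               ≤⟨ 2[k+r]≤n ⟩
      n                              ∎) ⟩
    n ∸ r'                       ≡⟨ cong (n ∸_) ∣p∣≡r' ⟨
    n ∸ ∣ p ∣                    ≡⟨ ∣∁p∣≡n∸∣p∣ p ⟨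
    ∣ ∁ p ∣                      ∎
    where open ≤-Reasoning

  saturated⇒¬minimum : ∀ {n r' k} {D : List (Subset n)} → IsMinKDominating n (suc r') k D →
    ∀ {ũ} → ∣ ũ ∣ ≡ r' → 2 * (k + suc r') ≤ n → ¬ (∀ x → x ∉ ũ → ũ ∪ ⁅ x ⁆ ∈ₗ D)
  saturated⇒¬minimum (D-kDom , D-minimum) {ũ} ∣ũ∣≡r' 2[k+r]≤n saturated
    with D' , D'-kDom , D'<D ← shorterKDominating D-kDom saturated (elements (∁ ũ))
      (Unique-elements (∁ ũ)) (tabulate (x∈∁p⇒x∉p ∘ ∈-elements⁻))
      (≤-trans (k+r+[1+k]≤∣∁p∣ ũ ∣ũ∣≡r' 2[k+r]≤n) (≤-reflexive (sym (length-elements (∁ ũ)))))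
    = <⇒≱ D'<D (D-minimum D' D'-kDom)

open import Data.Fin.Subset using (_∉_)
open import Data.List.Membership.Propositional using (_∈_)
open Kneser using (_∈ₗ?_; saturated⇒¬minimum)

mainTheorem2 : (k n r : ℕ) → 1 ≤ k → 1 ≤ r → 2 * (k + r) ≤ n →
    (D : List (Subset n)) → IsMinKDominating n r k D →
    (ũ : Subset n) → ∣ ũ ∣ ≡ r ∸ 1 →
    Σ (Fin n) (λ x → x ∉ ũ × ¬ ((ũ ∪ ⁅ x ⁆) ∈ D))
mainTheorem2 k n (suc r') _ (s≤s z≤n) 2[k+r]≤n D D-minimum ũ ∣ũ∣≡r'
  with any? (λ x → ¬? (x ∈? ũ) ×-dec ¬? (ũ ∪ ⁅ x ⁆ ∈ₗ? D))
... | yes witness   = witness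
... | no no-witness = ⊥-elim (saturated⇒¬minimum D-minimum ∣ũ∣≡r' 2[k+r]≤n saturated)
  where
  saturated : ∀ x → x ∉ ũ → ũ ∪ ⁅ x ⁆ ∈ D
  saturated x x∉ũ = decidable-stable (ũ ∪ ⁅ x ⁆ ∈ₗ? D) λ x∉D → no-witness (x , x∉ũ , x∉D)
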